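{- As formal power series in $q$ (equivalently, for $q$ in a sufficiently small neighborhood of $0$), $$\mathcal{L}(x;q):=\sum_{n\ge 1}\Big(\sum_{k=0}^{n-1} f_n(k,n-1)x^k\Big)q^n=\frac{q(1-q)^2}{(1-2q)(1-xq)}.$$
   Context: An inversion sequence of length $n$ is a sequence $e=e_1\cdots e_n$ of integers with $0\le e_i\le i-1$. The reduction of a word replaces each occurrence of the $k$-th smallest distinct entry by $k-1$; $e$ contains a pattern $p$ if some subsequence (entries at increasing positions) has reduction $p$, and avoids $p$ otherwise. $\mathbf{I}_n(0012)$ is the set of inversion sequences of length $n$ avoiding $0012$. For $e\in\mathbf{I}_n(0012)$, $\mathcal{R}(e)$ is the set of values appearing at least twice in $e$, $\textsc{srpt}(e)=\min\mathcal{R}(e)$ with the convention $\textsc{srpt}(01\cdots(n-1))=n-1$, and $\textsc{last}(e)=e_n$. $f_n(k,\ell)$ is the number of $e\in\mathbf{I}_n(0012)$ with $\textsc{srpt}(e)=k$ and $\textsc{last}(e)=\ell$. -}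

module Defs where

open import Data.Nat using (ℕ; zero; suc; _∸_; _⊓_; _<?_; _≤?_; _<_)
open import Data.Nat.Properties using (_≟_)
open import Data.Integer as ℤ using (ℤ; +_)
open import Data.List using (List; []; _∷_; _++_; [_]; map; concatMap; filter; length; upTo; foldr; deduplicate)
open import Data.List.Properties using (≡-dec)
open import Data.List.Relation.Unary.Any using (Any; any?)
open import Data.Product using (_×_)
open import Relation.Binary.PropositionalEquality using (_≡_)
open import Relation.Nullary using (¬_; Dec; yes; no; ¬?; _×-dec_)
open import Relation.Nullary.Decidable using (⌊_⌋)

-- Inversion sequences, as lists e₁ ⋯ eₙ of naturals with eᵢ ≤ i - 1.

invSeqs : ℕ → List (List ℕ)
invSeqs zero    = [] ∷ []
invSeqs (suc n) = concatMap (λ e → map (λ v → e ++ [ v ]) (upTo (suc n))) (invSeqs n)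

reduce : List ℕ → List ℕ
reduce w = map (λ a → length (filter (_<? a) (deduplicate _≟_ w))) w

subseqs : ℕ → List ℕ → List (List ℕ)
subseqs zero    _        = [] ∷ []
subseqs (suc m) []       = []
subseqs (suc m) (x ∷ xs) = map (x ∷_) (subseqs m xs) ++ subseqs (suc m) xs

Contains : List ℕ → List ℕ → Set
Contains p e = Any (λ s → reduce s ≡ p) (subseqs (length p) e)

contains? : (p e : List ℕ) → Dec (Contains p e)
contains? p e = any? (λ s → ≡-dec _≟_ (reduce s) p) (subseqs (length p) e)

Avoids : List ℕ → List ℕ → Set
Avoids p e = ¬ Contains p e

avoids? : (p e : List ℕ) → Dec (Avoids p e)
avoids? p e = ¬? (contains? p e)

p0012 : List ℕ
p0012 = 0 ∷ 0 ∷ 1 ∷ 2 ∷ []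

-- R(e): values appearing at least twice in e (values of an inversion
-- sequence of length n lie in {0,…,n-1}).
repeated : List ℕ → List ℕ
repeated e = filter (λ v → 2 ≤? length (filter (_≟ v) e)) (upTo (length e))

-- srpt(e) = min R(e), with convention srpt = n - 1 when R(e) = ∅
-- (which happens exactly for e = 01⋯(n-1)).
srpt : List ℕ → ℕ
srpt e with repeated e
... | []     = length e ∸ 1
... | v ∷ vs = foldr _⊓_ v vs

-- last(e) = eₙ (only used for n ≥ 1; the empty sequence gets 0)
lastEntry : List ℕ → ℕ
lastEntry []           = 0
lastEntry (x ∷ [])     = x
lastEntry (_ ∷ y ∷ ys) = lastEntry (y ∷ ys)

f : ℕ → ℕ → ℕ → ℕ
f n k ℓ = length (filter (λ e → avoids? p0012 e ×-dec (srpt e ≟ k ×-dec lastEntry e ≟ ℓ)) (invSeqs n))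

-- Formal power series in q with coefficients in ℤ[x], represented by
-- their coefficient arrays:  A n k = coefficient of xᵏ qⁿ.

Ser : Set
Ser = ℕ → ℕ → ℤ

Σ≤ : ℕ → (ℕ → ℤ) → ℤ
Σ≤ zero    g = g zero
Σ≤ (suc n) g = Σ≤ n g ℤ.+ g (suc n)

_⊕_ : Ser → Ser → Ser
(A ⊕ B) n k = A n k ℤ.+ B n k

_⊖_ : Ser → Ser → Ser
(A ⊖ B) n k = A n k ℤ.- B n k

_⊛_ : Ser → Ser → Ser
(A ⊛ B) n k = Σ≤ n (λ i → Σ≤ k (λ j → A i j ℤ.* B (n ∸ i) (k ∸ j)))

-- the monomial c · xᵃ qᵇ
mono : ℤ → ℕ → ℕ → Ser
mono c b a n k with b ≟ n | a ≟ k
... | yes _ | yes _ = c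
... | _         | _         = + 0

𝟙 𝕢 𝕩𝕢 : Ser
𝟙  = mono (+ 1) 0 0
𝕢  = mono (+ 1) 1 0
𝕩𝕢 = mono (+ 1) 1 1

𝓛 : Ser
𝓛 zero    k = + 0
𝓛 (suc m) k with k <? suc m
... | yes _ = + f (suc m) k m
... | no  _ = + 0

numer denom : Ser
numer = 𝕢 ⊛ ((𝟙 ⊖ 𝕢) ⊛ (𝟙 ⊖ 𝕢))
denom = (𝟙 ⊖ (𝕢 ⊕ 𝕢)) ⊛ (𝟙 ⊖ 𝕩𝕢)

module Submission where

-- Appending the new maximum n to an inversion sequence e of length n creates 0012 exactly when e
-- contains 001, and creates no repeated value, so f_{n+1}(k, n) counts the 001-avoiding e of
-- length n by srpt. Read left to right, such an e is 0 1 ⋯ up to its first repeat, and from then on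
-- each entry is at most the current least repeated value and becomes the new one. Propagating
-- this one step at a time shows that 2^(n-k-2) of them have srpt k < n-1, none has srpt n-1, and
-- only 0 1 ⋯ (n-1) has srpt n. Hence the coefficient L(n, k) of xᵏqⁿ satisfies
-- L(n+1, k+1) = L(n, k) and L(n+1, 0) = 2 L(n, 0) for n ≥ 3, which after checking the first
-- coefficients is the identity (1-2q)(1-xq) 𝓛 = q(1-q)².

open import Defs
open import Data.Nat using (ℕ; zero; suc; _^_)
open import Relation.Binary.PropositionalEquality using (_≡_; sym; trans)

twoPow∸2 : ℕ → ℕ
twoPow∸2 zero          = 0
twoPow∸2 (suc zero)    = 0
twoPow∸2 (suc (suc d)) = 2 ^ d

-- the coefficient of xᵏ qᵐ⁺¹ in 𝓛
𝓛-coeff : ℕ → ℕ → ℕ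
𝓛-coeff zero    zero    = 1
𝓛-coeff (suc m) zero    = twoPow∸2 (suc m)
𝓛-coeff zero    (suc k) = 0
𝓛-coeff (suc m) (suc k) = 𝓛-coeff m k

module Enumeration where

  open import Data.Nat.Base
  open import Data.Nat.Properties
  open import Data.Nat.Tactic.RingSolver using (solve-∀)
  open import Data.Bool.Base using (true; false; T; if_then_else_)
  open import Data.Empty using (⊥-elim)
  open import Data.Unit.Base using (⊤; tt)
  open import Data.Product.Base using (∃; ∃₂; _×_; _,_; proj₁)
  open import Data.Sum.Base using (_⊎_; inj₁; inj₂)
  import Data.Sum.Base as Sum
  open import Data.List.Base using (List; []; _∷_; _++_; [_]; map; filter; length; upTo; concatMap; deduplicate; replicate; foldr)
  open import Data.List.Properties
    using (∷-injectiveˡ; ∷-injectiveʳ; ∷ʳ-injective; ∷ʳ-injectiveˡ; filter-accept; filter-reject; filter-++; filter-none;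
           length-++; upTo-∷ʳ; foldr-preservesᵇ; foldr-preservesᵒ)
  open import Data.List.Membership.Propositional using (_∈_; find; lose)
  open import Data.List.Membership.Propositional.Properties
    using (∈-++⁻; ∈-++⁺ˡ; ∈-++⁺ʳ; ∈-map⁻; ∈-map⁺; ∈-deduplicate⁺; ∈-filter⁺; ∈-upTo⁺)
  open import Data.List.Relation.Unary.Any as Any using (here; there)
  open import Data.List.Relation.Unary.All as All using (All; []; _∷_)
  import Data.List.Relation.Unary.All.Properties as All
  open import Data.List.Relation.Binary.Sublist.Propositional using (_⊆_; []; _∷_; _∷ʳ_; ⊆-refl; ⊆-trans; lookup; minimum)
  open import Data.List.Relation.Binary.Sublist.Propositional.Properties using (++⁺; ++⁺ʳ)
  open import Function.Base using (id; _∘_)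
  open import Function.Bundles using (_⇔_; mk⇔; Equivalence)
  open import Relation.Binary.Definitions using (tri<; tri≈; tri>)
  open import Relation.Binary.PropositionalEquality hiding ([_])
  open import Relation.Nullary using (¬_; Dec; yes; no; does; contradiction)
  open import Relation.Nullary.Decidable using (_×-dec_)
  open import Relation.Unary using (Decidable)

  ≡ᵇ-refl : ∀ n → (n ≡ᵇ n) ≡ true
  ≡ᵇ-refl zero    = refl
  ≡ᵇ-refl (suc n) = ≡ᵇ-refl n

  false-if-¬T : ∀ {b} → ¬ T b → b ≡ false
  false-if-¬T {false} _  = refl
  false-if-¬T {true}  ¬t = ⊥-elim (¬t tt)

  true-if-T : ∀ {b} → T b → b ≡ true
  true-if-T {true} _ = refl

  ≡ᵇ-false : ∀ {m n} → m ≢ n → (m ≡ᵇ n) ≡ false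
  ≡ᵇ-false {m} {n} m≢n = false-if-¬T (m≢n ∘ ≡ᵇ⇒≡ m n)

  <ᵇ-true : ∀ {m n} → m < n → (m <ᵇ n) ≡ true
  <ᵇ-true m<n = true-if-T (<⇒<ᵇ m<n)

  <ᵇ-false : ∀ {m n} → n ≤ m → (m <ᵇ n) ≡ false
  <ᵇ-false {m} {n} n≤m = false-if-¬T (λ m<n → <⇒≱ (<ᵇ⇒< m n m<n) n≤m)

  -- reduce unfolds to the comparisons _≡ᵇ_ and _<ᵇ_ between entries; fixing each one computes it.
  reduce-aacd : ∀ {a c d} → a < c → c < d → reduce (a ∷ a ∷ c ∷ d ∷ []) ≡ p0012
  reduce-aacd {a} {c} {d} a<c c<d
    rewrite ≡ᵇ-refl a
          | ≡ᵇ-false (<⇒≢ c<d) | ≡ᵇ-false (<⇒≢ a<c) | ≡ᵇ-false (<⇒≢ (<-trans a<c c<d))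
          | ≡ᵇ-false (<⇒≢ a<c) | ≡ᵇ-false (<⇒≢ (<-trans a<c c<d))
          | <ᵇ-false (≤-refl {a}) | <ᵇ-true a<c | <ᵇ-true (<-trans a<c c<d) | <ᵇ-true c<d
          | <ᵇ-false (<⇒≤ a<c) | <ᵇ-false (≤-refl {c}) | <ᵇ-false (≤-refl {d})
          | <ᵇ-false (<⇒≤ (<-trans a<c c<d)) | <ᵇ-false (<⇒≤ c<d) = refl

  -- reduce w = map (λ a → below a (deduplicate _≟_ w)) w
  below : ℕ → List ℕ → ℕ
  below x L = length (filter (_<? x) L)

  below-∷-< : ∀ {x z} L → z < x → below x (z ∷ L) ≡ suc (below x L)
  below-∷-< {x} L z<x = cong length (filter-accept (_<? x) z<x)

  below-∷-≮ : ∀ {x z} L → ¬ z < x → below x (z ∷ L) ≡ below x L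
  below-∷-≮ {x} L z≮x = cong length (filter-reject (_<? x) z≮x)

  below-mono : ∀ L {x y} → x ≤ y → below x L ≤ below y L
  below-mono []      x≤y = z≤n
  below-mono (z ∷ L) {x} {y} x≤y with z <? x | z <? y
  ... | yes z<x | yes z<y = subst₂ _≤_ (sym (below-∷-< L z<x)) (sym (below-∷-< L z<y)) (s≤s (below-mono L x≤y))
  ... | yes z<x | no  z≮y = contradiction (<-≤-trans z<x x≤y) z≮y
  ... | no  z≮x | yes z<y = subst₂ _≤_ (sym (below-∷-≮ L z≮x)) (sym (below-∷-< L z<y)) (m≤n⇒m≤1+n (below-mono L x≤y))
  ... | no  z≮x | no  z≮y = subst₂ _≤_ (sym (below-∷-≮ L z≮x)) (sym (below-∷-≮ L z≮y)) (below-mono L x≤y)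

  below-strict : ∀ L {x y} → x ∈ L → x < y → below x L < below y L
  below-strict (z ∷ L) (here refl) x<y =
    subst₂ _<_ (sym (below-∷-≮ L (<-irrefl refl))) (sym (below-∷-< L x<y)) (s≤s (below-mono L (<⇒≤ x<y)))
  below-strict (z ∷ L) {x} {y} (there x∈L) x<y with z <? x | z <? y
  ... | yes z<x | yes z<y = subst₂ _<_ (sym (below-∷-< L z<x)) (sym (below-∷-< L z<y)) (s≤s (below-strict L x∈L x<y))
  ... | yes z<x | no  z≮y = contradiction (<-trans z<x x<y) z≮y
  ... | no  z≮x | yes z<y = subst₂ _<_ (sym (below-∷-≮ L z≮x)) (sym (below-∷-< L z<y)) (m<n⇒m<1+n (below-strict L x∈L x<y))
  ... | no  z≮x | no  z≮y = subst₂ _<_ (sym (below-∷-≮ L z≮x)) (sym (below-∷-≮ L z≮y)) (below-strict L x∈L x<y)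

  reduce≡0012⇒ : ∀ {a b c d} → reduce (a ∷ b ∷ c ∷ d ∷ []) ≡ p0012 → a ≡ b × a < c × c < d
  reduce≡0012⇒ {a} {b} {c} {d} red = a≡b , a<c , c<d
    where
    w = a ∷ b ∷ c ∷ d ∷ []
    rank : ℕ → ℕ
    rank x = below x (deduplicate _≟_ w)
    ra : rank a ≡ 0
    ra = ∷-injectiveˡ red
    rb : rank b ≡ 0
    rb = ∷-injectiveˡ (∷-injectiveʳ red)
    rc : rank c ≡ 1
    rc = ∷-injectiveˡ (∷-injectiveʳ (∷-injectiveʳ red))
    rd : rank d ≡ 2
    rd = ∷-injectiveˡ (∷-injectiveʳ (∷-injectiveʳ (∷-injectiveʳ red)))
    order : ∀ {x y} → x ∈ w → x < y → ∀ {i j} → rank x ≡ i → rank y ≡ j → i < j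
    order x∈w x<y refl refl = below-strict _ (∈-deduplicate⁺ _≟_ x∈w) x<y
    a≡b : a ≡ b
    a≡b with <-cmp a b
    ... | tri< a<b _ _ = contradiction (order (here refl) a<b ra rb) (<-irrefl refl)
    ... | tri≈ _ a≡b _ = a≡b
    ... | tri> _ _ b<a = contradiction (order (there (here refl)) b<a rb ra) (<-irrefl refl)
    a<c : a < c
    a<c with <-cmp a c
    ... | tri< a<c _ _    = a<c
    ... | tri≈ _ refl _   = contradiction (trans (sym ra) rc) λ ()
    ... | tri> _ _ c<a    = contradiction (order (there (there (here refl))) c<a rc ra) λ ()
    c<d : c < d
    c<d with <-cmp c d
    ... | tri< c<d _ _    = c<d
    ... | tri≈ _ refl _   = contradiction (trans (sym rc) rd) λ ()
    ... | tri> _ _ d<c    = contradiction (order (there (there (there (here refl)))) d<c rd rc) λ { (s≤s ()) }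

  subseqs⇒⊆ : ∀ m {s} e → s ∈ subseqs m e → s ⊆ e × length s ≡ m
  subseqs⇒⊆ zero    e        (here refl) = minimum e , refl
  subseqs⇒⊆ (suc m) (x ∷ e) s∈ with ∈-++⁻ (map (x ∷_) (subseqs m e)) s∈
  ... | inj₁ s∈keep with ∈-map⁻ (x ∷_) s∈keep
  ...   | t , t∈ , refl with subseqs⇒⊆ m e t∈
  ...     | t⊆e , refl = refl ∷ t⊆e , refl
  subseqs⇒⊆ (suc m) (x ∷ e) s∈ | inj₂ s∈skip with subseqs⇒⊆ (suc m) e s∈skip
  ... | s⊆e , len = x ∷ʳ s⊆e , len

  ⊆⇒subseqs : ∀ {s e} → s ⊆ e → s ∈ subseqs (length s) e
  ⊆⇒subseqs []                      = here refl
  ⊆⇒subseqs {[]}    (x ∷ʳ s⊆e)      = here refl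
  ⊆⇒subseqs {_ ∷ s} (x ∷ʳ s⊆e)      = ∈-++⁺ʳ (map (x ∷_) (subseqs (length s) _)) (⊆⇒subseqs s⊆e)
  ⊆⇒subseqs         (refl ∷ s⊆e)    = ∈-++⁺ˡ (∈-map⁺ _ (⊆⇒subseqs s⊆e))

  ⊆-snoc⁻ : ∀ {s} (e : List ℕ) v → s ⊆ e ++ [ v ] → s ⊆ e ⊎ ∃ λ s′ → s ≡ s′ ++ [ v ] × s′ ⊆ e
  ⊆-snoc⁻ []      v (.v ∷ʳ [])    = inj₁ []
  ⊆-snoc⁻ []      v (refl ∷ [])   = inj₂ ([] , refl , [])
  ⊆-snoc⁻ (x ∷ e) v (.x ∷ʳ s⊆)    =
    Sum.map (x ∷ʳ_) (λ (s′ , s≡ , s′⊆) → s′ , s≡ , x ∷ʳ s′⊆) (⊆-snoc⁻ e v s⊆)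
  ⊆-snoc⁻ (x ∷ e) v (refl ∷ s⊆)   =
    Sum.map (refl ∷_) (λ (s′ , s≡ , s′⊆) → x ∷ s′ , cong (x ∷_) s≡ , refl ∷ s′⊆) (⊆-snoc⁻ e v s⊆)

  All-resp-⊆ : ∀ {P : ℕ → Set} {s e} → s ⊆ e → All P e → All P s
  All-resp-⊆ s⊆e Pe = All.tabulate (All.lookup Pe ∘ lookup s⊆e)

  length-snoc : ∀ (e : List ℕ) v → length (e ++ [ v ]) ≡ suc (length e)
  length-snoc e v = trans (length-++ e) (+-comm (length e) 1)

  occ : ℕ → List ℕ → ℕ
  occ a e = length (filter (_≟ a) e)

  occ-∷-≡ : ∀ {a x} e → x ≡ a → occ a (x ∷ e) ≡ suc (occ a e)
  occ-∷-≡ {a} e x≡a = cong length (filter-accept (_≟ a) x≡a)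

  occ-∷-≢ : ∀ {a x} e → x ≢ a → occ a (x ∷ e) ≡ occ a e
  occ-∷-≢ {a} e x≢a = cong length (filter-reject (_≟ a) x≢a)

  occ-snoc : ∀ a e v → occ a (e ++ [ v ]) ≡ occ a e + occ a [ v ]
  occ-snoc a e v = trans (cong length (filter-++ (_≟ a) e [ v ])) (length-++ (filter (_≟ a) e))

  occ-snoc-≡ : ∀ a e → occ a (e ++ [ a ]) ≡ suc (occ a e)
  occ-snoc-≡ a e = trans (occ-snoc a e a) (trans (cong (occ a e +_) (occ-∷-≡ {a} [] refl)) (+-comm (occ a e) 1))

  occ-snoc-≢ : ∀ {a v} e → v ≢ a → occ a (e ++ [ v ]) ≡ occ a e
  occ-snoc-≢ {a} {v} e v≢a = trans (occ-snoc a e v) (trans (cong (occ a e +_) (occ-∷-≢ [] v≢a)) (+-identityʳ _))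

  occ-snoc-mono : ∀ a e v → occ a e ≤ occ a (e ++ [ v ])
  occ-snoc-mono a e v = subst (occ a e ≤_) (sym (occ-snoc a e v)) (m≤m+n (occ a e) (occ a [ v ]))

  occ-fresh : ∀ {n e} → All (_< n) e → occ n e ≡ 0
  occ-fresh []                  = refl
  occ-fresh {e = _ ∷ e} (x<n ∷ e<n) = trans (occ-∷-≢ e (<⇒≢ x<n)) (occ-fresh e<n)

  replicate-⊆⇒≤occ : ∀ j {a e} → replicate j a ⊆ e → j ≤ occ a e
  replicate-⊆⇒≤occ zero    _                      = z≤n
  replicate-⊆⇒≤occ (suc j) {a} (x ∷ʳ r⊆e) with x ≟ a
  ... | yes x≡a = ≤-trans (replicate-⊆⇒≤occ (suc j) r⊆e) (subst (_ ≤_) (sym (occ-∷-≡ {a} _ x≡a)) (n≤1+n _))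
  ... | no  x≢a = subst (suc j ≤_) (sym (occ-∷-≢ _ x≢a)) (replicate-⊆⇒≤occ (suc j) r⊆e)
  replicate-⊆⇒≤occ (suc j) {a} {_ ∷ e} (refl ∷ r⊆e) =
    subst (suc j ≤_) (sym (occ-∷-≡ {a} e refl)) (s≤s (replicate-⊆⇒≤occ j r⊆e))

  ≤occ⇒replicate-⊆ : ∀ j {a} e → j ≤ occ a e → replicate j a ⊆ e
  ≤occ⇒replicate-⊆ zero    e       _       = minimum e
  ≤occ⇒replicate-⊆ (suc j) {a} (x ∷ e) j<occ with x ≟ a
  ... | yes refl = refl ∷ ≤occ⇒replicate-⊆ j e (s≤s⁻¹ (subst (suc j ≤_) (occ-∷-≡ {a} e refl) j<occ))
  ... | no  x≢a  = x ∷ʳ ≤occ⇒replicate-⊆ (suc j) e (subst (suc j ≤_) (occ-∷-≢ e x≢a) j<occ)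

  Has001 : List ℕ → Set
  Has001 e = ∃₂ λ a c → a < c × a ∷ a ∷ c ∷ [] ⊆ e

  Has001-snoc : ∀ {e} v → Has001 e → Has001 (e ++ [ v ])
  Has001-snoc v (a , c , a<c , aac⊆e) = a , c , a<c , ++⁺ʳ [ v ] aac⊆e

  Has001-repeat : ∀ {r v} e → 2 ≤ occ r e → r < v → Has001 (e ++ [ v ])
  Has001-repeat e two r<v = _ , _ , r<v , ++⁺ (≤occ⇒replicate-⊆ 2 e two) ⊆-refl

  Has001-snoc⁻ : ∀ e v → Has001 (e ++ [ v ]) → Has001 e ⊎ ∃ λ a → a < v × 2 ≤ occ a e
  Has001-snoc⁻ e v (a , c , a<c , aac⊆) with ⊆-snoc⁻ e v aac⊆
  ... | inj₁ aac⊆e                          = inj₁ (a , c , a<c , aac⊆e)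
  ... | inj₂ (s′ , aac≡ , s′⊆e) with ∷ʳ-injective (a ∷ a ∷ []) s′ aac≡
  ...   | refl , refl = inj₂ (a , a<c , replicate-⊆⇒≤occ 2 s′⊆e)

  ¬Has001-snoc : ∀ e v → ¬ Has001 e → (∀ a → a < v → occ a e ≤ 1) → ¬ Has001 (e ++ [ v ])
  ¬Has001-snoc e v ¬has rare has with Has001-snoc⁻ e v has
  ... | inj₁ has-e           = ¬has has-e
  ... | inj₂ (a , a<v , two) = <⇒≱ (s≤s (rare a a<v)) two

  distinct⇒¬Has001 : ∀ {e} → (∀ a → occ a e ≤ 1) → ¬ Has001 e
  distinct⇒¬Has001 distinct (a , _ , _ , aac⊆e) =
    <⇒≱ (s≤s (distinct a)) (replicate-⊆⇒≤occ 2 (⊆-trans (++⁺ʳ _ ⊆-refl) aac⊆e))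

  -- Below a new maximum n, an occurrence of 0012 is an occurrence of 001 followed by n.
  contains0012⇔Has001 : ∀ {n e} → All (_< n) e → Contains p0012 (e ++ [ n ]) ⇔ Has001 e
  contains0012⇔Has001 {n} {e} e<n = mk⇔ to from
    where
    to : Contains p0012 (e ++ [ n ]) → Has001 e
    to has with find has
    ... | s , s∈ , red with subseqs⇒⊆ 4 (e ++ [ n ]) s∈
    ... | s⊆ , len with s | len
    ... | a ∷ b ∷ c ∷ d ∷ [] | refl with reduce≡0012⇒ {a} {b} {c} {d} red
    ... | refl , a<c , _ with ⊆-snoc⁻ e n s⊆
    ... | inj₁ aacd⊆e            = a , c , a<c , ⊆-trans (++⁺ʳ [ d ] ⊆-refl) aacd⊆e
    ... | inj₂ (s′ , s≡ , s′⊆e)  =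
      a , c , a<c , subst (_⊆ e) (sym (∷ʳ-injectiveˡ (a ∷ a ∷ c ∷ []) s′ s≡)) s′⊆e
    from : Has001 e → Contains p0012 (e ++ [ n ])
    from (a , c , a<c , aac⊆e) with All-resp-⊆ aac⊆e e<n
    ... | _ ∷ _ ∷ c<n ∷ [] = lose (⊆⇒subseqs (++⁺ aac⊆e ⊆-refl)) (reduce-aacd a<c c<n)

  -- How a prefix looks to a 001-avoiding continuation: has001 once it contains 001,
  -- ident while it is 0 1 ⋯ (m-1), and rep r when its last entry r is its least repeated value.
  data Shape : Set where
    has001 ident : Shape
    rep          : ℕ → Shape

  step : Shape → ℕ → ℕ → Shape
  step has001  m v = has001
  step ident   m v with v ≟ m
  ... | yes _ = ident
  ... | no  _ = rep v
  step (rep r) m v with v ≤? r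
  ... | yes _ = rep v
  ... | no  _ = has001

  run : Shape → ℕ → List ℕ → Shape
  run s m []       = s
  run s m (v ∷ vs) = run (step s m v) (suc m) vs

  shape : List ℕ → Shape
  shape = run ident 0

  run-snoc : ∀ s m e v → run s m (e ++ [ v ]) ≡ step (run s m e) (m + length e) v
  run-snoc s m []      v = cong (λ i → step s i v) (sym (+-identityʳ m))
  run-snoc s m (x ∷ e) v =
    trans (run-snoc (step s m x) (suc m) e v) (cong (λ i → step (run (step s m x) (suc m) e) i v) (sym (+-suc m (length e))))

  shape-snoc : ∀ e v → shape (e ++ [ v ]) ≡ step (shape e) (length e) v
  shape-snoc = run-snoc ident 0

  Spec : ℕ → List ℕ → Shape → Set
  Spec m e has001  = Has001 e
  Spec m e ident   = (∀ a → occ a e ≤ 1) × (∀ u → u < m → 1 ≤ occ u e)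
  Spec m e (rep r) = r < m × 2 ≤ occ r e × (∀ a → a < r → occ a e ≤ 1) × (∀ u → u ≤ r → 1 ≤ occ u e) × ¬ Has001 e

  step-spec : ∀ m e v s → v < suc m → All (_< m) e → Spec m e s → Spec (suc m) (e ++ [ v ]) (step s m v)
  step-spec m e v has001 v≤m e<m has = Has001-snoc v has
  step-spec m e v ident  v≤m e<m (distinct , covers) with v ≟ m
  ... | yes refl = distinct′ , covers′
    where
    distinct′ : ∀ a → occ a (e ++ [ v ]) ≤ 1
    distinct′ a with v ≟ a
    ... | yes refl = ≤-reflexive (trans (occ-snoc-≡ v e) (cong suc (occ-fresh e<m)))
    ... | no  v≢a  = subst (_≤ 1) (sym (occ-snoc-≢ e v≢a)) (distinct a)
    covers′ : ∀ u → u < suc m → 1 ≤ occ u (e ++ [ v ])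
    covers′ u u≤m with u ≟ v
    ... | yes refl = subst (1 ≤_) (sym (occ-snoc-≡ u e)) (s≤s z≤n)
    ... | no  u≢v  = ≤-trans (covers u (≤∧≢⇒< (s≤s⁻¹ u≤m) u≢v)) (occ-snoc-mono u e v)
  ... | no v≢m = m<n⇒m<1+n v<m , v-repeated , distinct-below , covers′ ,
                 ¬Has001-snoc e v (distinct⇒¬Has001 distinct) (λ a _ → distinct a)
    where
    v<m : v < m
    v<m = ≤∧≢⇒< (s≤s⁻¹ v≤m) v≢m
    v-repeated : 2 ≤ occ v (e ++ [ v ])
    v-repeated = subst (2 ≤_) (sym (occ-snoc-≡ v e)) (s≤s (covers v v<m))
    distinct-below : ∀ a → a < v → occ a (e ++ [ v ]) ≤ 1
    distinct-below a a<v = subst (_≤ 1) (sym (occ-snoc-≢ e (≢-sym (<⇒≢ a<v)))) (distinct a)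
    covers′ : ∀ u → u ≤ v → 1 ≤ occ u (e ++ [ v ])
    covers′ u u≤v = ≤-trans (covers u (≤-<-trans u≤v v<m)) (occ-snoc-mono u e v)
  step-spec m e v (rep r) v≤m e<m (r<m , r-repeated , distinct-below , covers , ¬has) with v ≤? r
  ... | no  v≰r = Has001-repeat e r-repeated (≰⇒> v≰r)
  ... | yes v≤r = ≤-<-trans v≤r (m<n⇒m<1+n r<m) , v-repeated , distinct-below′ , covers′ ,
                  ¬Has001-snoc e v ¬has (λ a a<v → distinct-below a (<-≤-trans a<v v≤r))
    where
    v-repeated : 2 ≤ occ v (e ++ [ v ])
    v-repeated = subst (2 ≤_) (sym (occ-snoc-≡ v e)) (s≤s (covers v v≤r))
    distinct-below′ : ∀ a → a < v → occ a (e ++ [ v ]) ≤ 1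
    distinct-below′ a a<v =
      subst (_≤ 1) (sym (occ-snoc-≢ e (≢-sym (<⇒≢ a<v)))) (distinct-below a (<-≤-trans a<v v≤r))
    covers′ : ∀ u → u ≤ v → 1 ≤ occ u (e ++ [ v ])
    covers′ u u≤v = ≤-trans (covers u (≤-trans u≤v v≤r)) (occ-snoc-mono u e v)

  Inv : ℕ → List ℕ → Set
  Inv m e = length e ≡ m × All (_< m) e × Spec m e (shape e)

  Inv-snoc : ∀ {m e v} → v < suc m → Inv m e → Inv (suc m) (e ++ [ v ])
  Inv-snoc {m} {e} {v} v≤m (len , e<m , spec) =
    trans (length-snoc e v) (cong suc len) ,
    All.++⁺ (All.map m<n⇒m<1+n e<m) (v≤m ∷ []) ,
    subst (Spec (suc m) (e ++ [ v ])) (sym (trans (shape-snoc e v) (cong (λ i → step (shape e) i v) len)))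
          (step-spec m e v (shape e) v≤m e<m spec)

  Inv-invSeqs : ∀ m → All (Inv m) (invSeqs m)
  Inv-invSeqs zero    = (refl , [] , (λ a → z≤n) , (λ u ())) ∷ []
  Inv-invSeqs (suc m) =
    All.concat⁺ (All.map⁺ (All.map (λ I → All.map⁺ (All.applyUpTo⁺₁ id (suc m) (λ v≤m → Inv-snoc v≤m I)))
                                   (Inv-invSeqs m)))

  private variable A B : Set

  ∑ : (A → ℕ) → List A → ℕ
  ∑ f []       = 0
  ∑ f (x ∷ xs) = f x + ∑ f xs

  ∑-++ : ∀ (f : A → ℕ) xs ys → ∑ f (xs ++ ys) ≡ ∑ f xs + ∑ f ys
  ∑-++ f []       ys = refl
  ∑-++ f (x ∷ xs) ys = trans (cong (f x +_) (∑-++ f xs ys)) (sym (+-assoc (f x) _ _))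

  ∑-cong : ∀ {f g : A → ℕ} {xs} → All (λ x → f x ≡ g x) xs → ∑ f xs ≡ ∑ g xs
  ∑-cong []            = refl
  ∑-cong (fx≡gx ∷ eqs) = cong₂ _+_ fx≡gx (∑-cong eqs)

  ∑-distrib-+ : ∀ (f g : A → ℕ) xs → ∑ (λ x → f x + g x) xs ≡ ∑ f xs + ∑ g xs
  ∑-distrib-+ f g []       = refl
  ∑-distrib-+ f g (x ∷ xs) = trans (cong (f x + g x +_) (∑-distrib-+ f g xs)) (interchange (f x) (g x) _ _)
    where
    interchange : ∀ a b c d → (a + b) + (c + d) ≡ (a + c) + (b + d)
    interchange = solve-∀

  ∑-*ˡ : ∀ c (f : A → ℕ) xs → ∑ (λ x → c * f x) xs ≡ c * ∑ f xs
  ∑-*ˡ c f []       = sym (*-zeroʳ c)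
  ∑-*ˡ c f (x ∷ xs) = trans (cong (c * f x +_) (∑-*ˡ c f xs)) (sym (*-distribˡ-+ c (f x) (∑ f xs)))

  ∑-map : ∀ (f : B → ℕ) (g : A → B) xs → ∑ f (map g xs) ≡ ∑ (f ∘ g) xs
  ∑-map f g []       = refl
  ∑-map f g (x ∷ xs) = cong (f (g x) +_) (∑-map f g xs)

  ∑-concatMap : ∀ (f : B → ℕ) (g : A → List B) xs → ∑ f (concatMap g xs) ≡ ∑ (∑ f ∘ g) xs
  ∑-concatMap f g []       = refl
  ∑-concatMap f g (x ∷ xs) = trans (∑-++ f (g x) (concatMap g xs)) (cong (∑ f (g x) +_) (∑-concatMap f g xs))

  indicator : {P : Set} → Dec P → ℕ
  indicator p? = if does p? then 1 else 0

  length-filter : ∀ {P : A → Set} (P? : Decidable P) xs → length (filter P? xs) ≡ ∑ (indicator ∘ P?) xs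
  length-filter P? []       = refl
  length-filter P? (x ∷ xs) with P? x
  ... | yes _ = cong suc (length-filter P? xs)
  ... | no  _ = length-filter P? xs

  indicator-no : ∀ {P : Set} (p? : Dec P) → ¬ P → indicator p? ≡ 0
  indicator-no (yes p) ¬p = contradiction p ¬p
  indicator-no (no _)  _  = refl

  indicator-middle : ∀ {P Q R : Set} (p? : Dec P) (q? : Dec Q) (r? : Dec R) → P → R →
                     indicator (p? ×-dec (q? ×-dec r?)) ≡ indicator q?
  indicator-middle (yes _) (yes _) (yes _) _ _ = refl
  indicator-middle (yes _) (no _)  _       _ _ = refl
  indicator-middle (yes _) _       (no ¬r) _ r = contradiction r ¬r
  indicator-middle (no ¬p) _       _       p _ = contradiction p ¬p

  Σ< : ℕ → (ℕ → ℕ) → ℕ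
  Σ< N f = ∑ f (upTo N)

  Σ<-suc : ∀ N f → Σ< (suc N) f ≡ Σ< N f + f N
  Σ<-suc N f = trans (cong (∑ f) (sym (upTo-∷ʳ N))) (trans (∑-++ f (upTo N) [ N ]) (cong (Σ< N f +_) (+-identityʳ (f N))))

  Σ<-front : ∀ N f → Σ< (suc N) f ≡ f 0 + Σ< N (λ r → f (suc r))
  Σ<-front zero    f = refl
  Σ<-front (suc N) f = begin
    Σ< (suc (suc N)) f                          ≡⟨ Σ<-suc (suc N) f ⟩
    Σ< (suc N) f + f (suc N)                    ≡⟨ cong (_+ f (suc N)) (Σ<-front N f) ⟩
    f 0 + Σ< N (λ r → f (suc r)) + f (suc N)    ≡⟨ +-assoc (f 0) _ _ ⟩
    f 0 + (Σ< N (λ r → f (suc r)) + f (suc N))  ≡⟨ cong (f 0 +_) (Σ<-suc N (λ r → f (suc r))) ⟨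
    f 0 + Σ< (suc N) (λ r → f (suc r))          ∎
    where open ≡-Reasoning

  Σ<-cong : ∀ N {f g} → (∀ {v} → v < N → f v ≡ g v) → Σ< N f ≡ Σ< N g
  Σ<-cong N f≡g = ∑-cong (All.applyUpTo⁺₁ id N f≡g)

  Σ<-zero : ∀ N f → (∀ {v} → v < N → f v ≡ 0) → Σ< N f ≡ 0
  Σ<-zero zero    f f≡0 = refl
  Σ<-zero (suc N) f f≡0 =
    trans (Σ<-suc N f) (cong₂ _+_ (Σ<-zero N f (f≡0 ∘ m<n⇒m<1+n)) (f≡0 ≤-refl))

  Σ<-truncate : ∀ {K} N f → K ≤ N → (∀ {v} → K ≤ v → v < N → f v ≡ 0) → Σ< N f ≡ Σ< K f
  Σ<-truncate zero    f z≤n   _   = refl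
  Σ<-truncate {K} (suc N) f K≤1+N f≡0 with m≤n⇒m<n∨m≡n K≤1+N
  ... | inj₂ refl  = refl
  ... | inj₁ K<1+N = begin
    Σ< (suc N) f     ≡⟨ Σ<-suc N f ⟩
    Σ< N f + f N     ≡⟨ cong₂ _+_ (Σ<-truncate N f K≤N (λ K≤v v<N → f≡0 K≤v (m<n⇒m<1+n v<N))) (f≡0 K≤N ≤-refl) ⟩
    Σ< K f + 0       ≡⟨ +-identityʳ _ ⟩
    Σ< K f           ∎
    where
    open ≡-Reasoning
    K≤N = s≤s⁻¹ K<1+N

  Σ<-single : ∀ N f {k} → k < N → (∀ {v} → v < N → v ≢ k → f v ≡ 0) → Σ< N f ≡ f k
  Σ<-single (suc N) f {k} k<1+N f≡0 with k ≟ N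
  ... | yes refl = trans (Σ<-suc N f) (cong (_+ f k) (Σ<-zero N f (λ v<N → f≡0 (m<n⇒m<1+n v<N) (<⇒≢ v<N))))
  ... | no  k≢N  = trans (Σ<-suc N f)
    (trans (cong₂ _+_ (Σ<-single N f (≤∧≢⇒< (s≤s⁻¹ k<1+N) k≢N) (f≡0 ∘ m<n⇒m<1+n)) (f≡0 ≤-refl (k≢N ∘ sym)))
           (+-identityʳ (f k)))

  ∑-invSeqs-suc : ∀ m (F : List ℕ → ℕ) →
                  ∑ F (invSeqs (suc m)) ≡ ∑ (λ e → Σ< (suc m) (λ v → F (e ++ [ v ]))) (invSeqs m)
  ∑-invSeqs-suc m F =
    trans (∑-concatMap F _ (invSeqs m))
          (∑-cong {xs = invSeqs m} (All.tabulate (λ {e} _ → ∑-map F (λ v → e ++ [ v ]) (upTo (suc m)))))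

  weigh : ℕ → (ℕ → ℕ) → Shape → ℕ
  weigh a F has001  = 0
  weigh a F ident   = a
  weigh a F (rep r) = F r

  Bounded : ℕ → Shape → Set
  Bounded m (rep r) = r < m
  Bounded m _       = ⊤

  Spec⇒Bounded : ∀ {m e} s → Spec m e s → Bounded m s
  Spec⇒Bounded has001  _             = tt
  Spec⇒Bounded ident   _             = tt
  Spec⇒Bounded (rep r) (r<m , _)     = r<m

  step-ident-≡ : ∀ m → step ident m m ≡ ident
  step-ident-≡ m with m ≟ m
  ... | yes _   = refl
  ... | no  m≢m = contradiction refl m≢m

  step-ident-≢ : ∀ {m v} → v ≢ m → step ident m v ≡ rep v
  step-ident-≢ {m} {v} v≢m with v ≟ m
  ... | yes v≡m = contradiction v≡m v≢m
  ... | no  _   = refl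

  step-rep-≤ : ∀ {r m v} → v ≤ r → step (rep r) m v ≡ rep v
  step-rep-≤ {r} {m} {v} v≤r with v ≤? r
  ... | yes _   = refl
  ... | no  v≰r = contradiction v≤r v≰r

  step-rep-> : ∀ {r m v} → r < v → step (rep r) m v ≡ has001
  step-rep-> {r} {m} {v} r<v with v ≤? r
  ... | yes v≤r = contradiction v≤r (<⇒≱ r<v)
  ... | no  _   = refl

  Σ<-weigh-step : ∀ m a F s → Bounded m s →
                  Σ< (suc m) (λ v → weigh a F (step s m v)) ≡ weigh (a + Σ< m F) (λ r → Σ< (suc r) F) s
  Σ<-weigh-step m a F has001 _ = Σ<-zero (suc m) _ (λ _ → refl)
  Σ<-weigh-step m a F ident  _ = begin
    Σ< (suc m) (λ v → weigh a F (step ident m v))               ≡⟨ Σ<-suc m _ ⟩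
    Σ< m (λ v → weigh a F (step ident m v)) + weigh a F (step ident m m)
      ≡⟨ cong₂ _+_ (Σ<-cong m (λ v<m → cong (weigh a F) (step-ident-≢ (<⇒≢ v<m)))) (cong (weigh a F) (step-ident-≡ m)) ⟩
    Σ< m F + a                                                   ≡⟨ +-comm (Σ< m F) a ⟩
    a + Σ< m F                                                   ∎
    where open ≡-Reasoning
  Σ<-weigh-step m a F (rep r) r<m = begin
    Σ< (suc m) (λ v → weigh a F (step (rep r) m v))
      ≡⟨ Σ<-truncate (suc m) (λ v → weigh a F (step (rep r) m v)) (m<n⇒m<1+n r<m)
                     (λ r<v _ → cong (weigh a F) (step-rep-> {m = m} r<v)) ⟩
    Σ< (suc r) (λ v → weigh a F (step (rep r) m v))
      ≡⟨ Σ<-cong (suc r) (λ v≤r → cong (weigh a F) (step-rep-≤ {m = m} (s≤s⁻¹ v≤r))) ⟩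
    Σ< (suc r) F                                                 ∎
    where open ≡-Reasoning

  twoPow∸2-geometric : ∀ m → suc (twoPow∸2 (suc m) + Σ< m (λ r → twoPow∸2 (m ∸ r))) ≡ twoPow∸2 (suc (suc m))
  twoPow∸2-geometric zero    = refl
  twoPow∸2-geometric (suc m) = begin
    suc (2 ^ m + Σ< (suc m) (λ r → twoPow∸2 (suc m ∸ r)))
      ≡⟨ cong (λ z → suc (2 ^ m + z)) (Σ<-front m (λ r → twoPow∸2 (suc m ∸ r))) ⟩
    suc (2 ^ m + (twoPow∸2 (suc m) + Σ< m (λ r → twoPow∸2 (m ∸ r))))
      ≡⟨ +-suc (2 ^ m) _ ⟨
    2 ^ m + suc (twoPow∸2 (suc m) + Σ< m (λ r → twoPow∸2 (m ∸ r)))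
      ≡⟨ cong (2 ^ m +_) (twoPow∸2-geometric m) ⟩
    2 ^ m + 2 ^ m
      ≡⟨ cong (2 ^ m +_) (+-identityʳ (2 ^ m)) ⟨
    2 ^ suc m ∎
    where open ≡-Reasoning

  twoPow∸2-convolution : ∀ m F →
    Σ< m F + Σ< m (λ r → twoPow∸2 (m ∸ r) * Σ< (suc r) F) ≡ Σ< (suc m) (λ r → twoPow∸2 (suc m ∸ r) * F r)
  twoPow∸2-convolution zero    F = refl
  twoPow∸2-convolution (suc m) F = begin
    Σ< (suc m) F + Σ< (suc m) (λ r → h (suc m ∸ r) * Σ< (suc r) F)
      ≡⟨ cong₂ _+_ (Σ<-front m F) (Σ<-front m (λ r → h (suc m ∸ r) * Σ< (suc r) F)) ⟩
    (F 0 + Σ< m F′) + (h (suc m) * (F 0 + 0) + Σ< m (λ r → h (m ∸ r) * Σ< (suc (suc r)) F))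
      ≡⟨ cong (λ z → (F 0 + Σ< m F′) + (h (suc m) * (F 0 + 0) + z)) split-first ⟩
    (F 0 + Σ< m F′) + (h (suc m) * (F 0 + 0) + (F 0 * G + X))
      ≡⟨ rearrange (F 0) (Σ< m F′) (h (suc m)) G X ⟩
    F 0 * suc (h (suc m) + G) + (Σ< m F′ + X)
      ≡⟨ cong₂ _+_ (cong (F 0 *_) (twoPow∸2-geometric m)) (twoPow∸2-convolution m F′) ⟩
    F 0 * h (suc (suc m)) + Σ< (suc m) (λ r → h (suc m ∸ r) * F′ r)
      ≡⟨ cong (_+ Σ< (suc m) (λ r → h (suc m ∸ r) * F′ r)) (*-comm (F 0) _) ⟩
    h (suc (suc m)) * F 0 + Σ< (suc m) (λ r → h (suc m ∸ r) * F′ r)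
      ≡⟨ Σ<-front (suc m) (λ r → h (suc (suc m) ∸ r) * F r) ⟨
    Σ< (suc (suc m)) (λ r → h (suc (suc m) ∸ r) * F r) ∎
    where
    open ≡-Reasoning
    h = twoPow∸2
    F′ = λ r → F (suc r)
    G = Σ< m (λ r → h (m ∸ r))
    X = Σ< m (λ r → h (m ∸ r) * Σ< (suc r) F′)
    split-first : Σ< m (λ r → h (m ∸ r) * Σ< (suc (suc r)) F) ≡ F 0 * G + X
    split-first = begin
      Σ< m (λ r → h (m ∸ r) * Σ< (suc (suc r)) F)
        ≡⟨ Σ<-cong m (λ {r} _ → trans (cong (h (m ∸ r) *_) (Σ<-front (suc r) F))
                                      (trans (*-distribˡ-+ (h (m ∸ r)) (F 0) _)
                                             (cong (_+ h (m ∸ r) * Σ< (suc r) F′) (*-comm (h (m ∸ r)) (F 0))))) ⟩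
      Σ< m (λ r → F 0 * h (m ∸ r) + h (m ∸ r) * Σ< (suc r) F′)
        ≡⟨ ∑-distrib-+ (λ r → F 0 * h (m ∸ r)) _ (upTo m) ⟩
      Σ< m (λ r → F 0 * h (m ∸ r)) + X
        ≡⟨ cong (_+ X) (∑-*ˡ (F 0) (λ r → h (m ∸ r)) (upTo m)) ⟩
      F 0 * G + X ∎
    rearrange : ∀ a s t g x → (a + s) + (t * (a + 0) + (a * g + x)) ≡ a * (1 + (t + g)) + (s + x)
    rearrange = solve-∀

  -- Among the inversion sequences of length m only 0 1 ⋯ (m-1) has shape ident,
  -- and exactly twoPow∸2 (m ∸ r) of them have shape rep r.
  ∑-weigh-shape : ∀ m a F → ∑ (weigh a F ∘ shape) (invSeqs m) ≡ a + Σ< m (λ r → twoPow∸2 (m ∸ r) * F r)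
  ∑-weigh-shape zero    a F = refl
  ∑-weigh-shape (suc m) a F = begin
    ∑ (weigh a F ∘ shape) (invSeqs (suc m))
      ≡⟨ ∑-invSeqs-suc m _ ⟩
    ∑ (λ e → Σ< (suc m) (λ v → weigh a F (shape (e ++ [ v ])))) (invSeqs m)
      ≡⟨ ∑-cong (All.map appended (Inv-invSeqs m)) ⟩
    ∑ (weigh (a + Σ< m F) (λ r → Σ< (suc r) F) ∘ shape) (invSeqs m)
      ≡⟨ ∑-weigh-shape m _ _ ⟩
    (a + Σ< m F) + Σ< m (λ r → twoPow∸2 (m ∸ r) * Σ< (suc r) F)
      ≡⟨ +-assoc a _ _ ⟩
    a + (Σ< m F + Σ< m (λ r → twoPow∸2 (m ∸ r) * Σ< (suc r) F))
      ≡⟨ cong (a +_) (twoPow∸2-convolution m F) ⟩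
    a + Σ< (suc m) (λ r → twoPow∸2 (suc m ∸ r) * F r) ∎
    where
    open ≡-Reasoning
    appended : ∀ {e} → Inv m e →
               Σ< (suc m) (λ v → weigh a F (shape (e ++ [ v ]))) ≡ weigh (a + Σ< m F) (λ r → Σ< (suc r) F) (shape e)
    appended {e} (len , _ , spec) =
      trans (Σ<-cong (suc m) (λ {v} _ → cong (weigh a F) (trans (shape-snoc e v) (cong (λ i → step (shape e) i v) len))))
            (Σ<-weigh-step m a F (shape e) (Spec⇒Bounded (shape e) spec))

  foldr-⊓-least : ∀ {r} v vs → r ∈ v ∷ vs → All (r ≤_) (v ∷ vs) → foldr _⊓_ v vs ≡ r
  foldr-⊓-least v vs r∈ (r≤v ∷ r≤vs) =
    ≤-antisym (foldr-preservesᵒ (λ x y → Sum.[ m≤n⇒m⊓o≤n y , m≤n⇒o⊓m≤n x ]) v vs (attained r∈))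
              (foldr-preservesᵇ ⊓-glb r≤v r≤vs)
    where
    attained : ∀ {r} → r ∈ v ∷ vs → v ≤ r ⊎ Any.Any (_≤ r) vs
    attained (here r≡v)  = inj₁ (≤-reflexive (sym r≡v))
    attained (there r∈vs) = inj₂ (Any.map (≤-reflexive ∘ sym) r∈vs)

  srpt-none : ∀ e → repeated e ≡ [] → srpt e ≡ length e ∸ 1
  srpt-none e none with repeated e
  ... | []    = refl
  ... | _ ∷ _ = contradiction none λ ()

  srpt-distinct : ∀ e → (∀ a → occ a e ≤ 1) → srpt e ≡ length e ∸ 1
  srpt-distinct e distinct =
    srpt-none e (filter-none (λ v → 2 ≤? occ v e) (All.applyUpTo⁺₂ id (length e) (λ v → <⇒≱ (s≤s (distinct v)))))

  srpt-least : ∀ e {r} → r ∈ repeated e → All (r ≤_) (repeated e) → srpt e ≡ r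
  srpt-least e r∈ r≤ with repeated e
  ... | []     = contradiction r∈ λ ()
  ... | v ∷ vs = foldr-⊓-least v vs r∈ r≤

  srpt-least-repeated : ∀ e {r} → r < length e → 2 ≤ occ r e → (∀ a → a < r → occ a e ≤ 1) → srpt e ≡ r
  srpt-least-repeated e {r} r<len r-repeated rare =
    srpt-least e (∈-filter⁺ repeats? (∈-upTo⁺ r<len) r-repeated)
                 (All.map (λ w-repeated → ≮⇒≥ (λ w<r → <⇒≱ (s≤s (rare _ w<r)) w-repeated))
                          (All.all-filter repeats? (upTo (length e))))
    where
    repeats? = λ v → 2 ≤? occ v e

  lastEntry-snoc : ∀ e v → lastEntry (e ++ [ v ]) ≡ v
  lastEntry-snoc []           v = refl
  lastEntry-snoc (x ∷ [])     v = refl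
  lastEntry-snoc (x ∷ y ∷ ys) v = lastEntry-snoc (y ∷ ys) v

  counted? : ∀ k ℓ (e : List ℕ) → Dec (Avoids p0012 e × srpt e ≡ k × lastEntry e ≡ ℓ)
  counted? k ℓ e = avoids? p0012 e ×-dec (srpt e ≟ k ×-dec lastEntry e ≟ ℓ)

  indicator-yes : ∀ {P : Set} (p? : Dec P) → P → indicator p? ≡ 1
  indicator-yes (yes _) _ = refl
  indicator-yes (no ¬p) p = contradiction p ¬p

  indicator-append-max : ∀ {n e} k → Inv n e →
    indicator (counted? k n (e ++ [ n ])) ≡ weigh (indicator (n ≟ k)) (λ r → indicator (r ≟ k)) (shape e)
  indicator-append-max {n} {e} k (len , e<n , spec) = by-shape (shape e) spec
    where
    e′ = e ++ [ n ]
    len′ : length e′ ≡ suc n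
    len′ = trans (length-snoc e n) (cong suc len)
    counted-by-srpt : ∀ {x} → ¬ Has001 e → srpt e′ ≡ x → indicator (counted? k n e′) ≡ indicator (x ≟ k)
    counted-by-srpt ¬has srpt≡x =
      trans (indicator-middle (avoids? p0012 e′) (srpt e′ ≟ k) (lastEntry e′ ≟ n)
                              (¬has ∘ Equivalence.to (contains0012⇔Has001 e<n)) (lastEntry-snoc e n))
            (cong (λ x → indicator (x ≟ k)) srpt≡x)
    by-shape : ∀ s → Spec n e s → indicator (counted? k n e′) ≡ weigh (indicator (n ≟ k)) (λ r → indicator (r ≟ k)) s
    by-shape has001 has =
      indicator-no (counted? k n e′) (λ (avoids , _) → avoids (Equivalence.from (contains0012⇔Has001 e<n) has))
    by-shape ident (distinct , covers) =
      counted-by-srpt (distinct⇒¬Has001 distinct) (trans (srpt-distinct e′ distinct′) (cong (_∸ 1) len′))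
      where
      distinct′ : ∀ a → occ a e′ ≤ 1
      distinct′ = proj₁ (subst (Spec (suc n) e′) (step-ident-≡ n) (step-spec n e n ident ≤-refl e<n (distinct , covers)))
    by-shape (rep r) (r<n , r-repeated , rare , _ , ¬has) =
      counted-by-srpt ¬has (srpt-least-repeated e′ (subst (r <_) (sym len′) (m<n⇒m<1+n r<n))
                                                   (≤-trans r-repeated (occ-snoc-mono r e n)) rare′)
      where
      rare′ : ∀ a → a < r → occ a e′ ≤ 1
      rare′ a a<r = subst (_≤ 1) (sym (occ-snoc-≢ e (≢-sym (<⇒≢ (<-trans a<r r<n))))) (rare a a<r)

  𝓛-coeff-≡ : ∀ m k → k ≤ m → indicator (m ≟ k) + twoPow∸2 (m ∸ k) ≡ 𝓛-coeff m k
  𝓛-coeff-≡ zero    zero    _         = refl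
  𝓛-coeff-≡ (suc m) zero    _         = refl
  𝓛-coeff-≡ (suc m) (suc k) (s≤s k≤m) = 𝓛-coeff-≡ m k k≤m

  𝓛-coeff-above : ∀ m k → m < k → 𝓛-coeff m k ≡ 0
  𝓛-coeff-above zero    (suc k) _         = refl
  𝓛-coeff-above (suc m) (suc k) (s≤s m<k) = 𝓛-coeff-above m k m<k

  f-last-max : ∀ m k → k ≤ m → f (suc m) k m ≡ 𝓛-coeff m k
  f-last-max m k k≤m = begin
    f (suc m) k m
      ≡⟨ length-filter (counted? k m) (invSeqs (suc m)) ⟩
    ∑ (indicator ∘ counted? k m) (invSeqs (suc m))
      ≡⟨ ∑-invSeqs-suc m _ ⟩
    ∑ (λ e → Σ< (suc m) (λ v → indicator (counted? k m (e ++ [ v ])))) (invSeqs m)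
      ≡⟨ ∑-cong (All.map last-is-max (Inv-invSeqs m)) ⟩
    ∑ (weigh (indicator (m ≟ k)) (λ r → indicator (r ≟ k)) ∘ shape) (invSeqs m)
      ≡⟨ ∑-weigh-shape m _ _ ⟩
    indicator (m ≟ k) + Σ< m (λ r → twoPow∸2 (m ∸ r) * indicator (r ≟ k))
      ≡⟨ cong (λ z → indicator (m ≟ k) + z) picks-k ⟩
    indicator (m ≟ k) + twoPow∸2 (m ∸ k)
      ≡⟨ 𝓛-coeff-≡ m k k≤m ⟩
    𝓛-coeff m k ∎
    where
    open ≡-Reasoning
    last-is-max : ∀ {e} → Inv m e → Σ< (suc m) (λ v → indicator (counted? k m (e ++ [ v ])))
                                    ≡ weigh (indicator (m ≟ k)) (λ r → indicator (r ≟ k)) (shape e)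
    last-is-max {e} I = begin
      Σ< (suc m) (λ v → indicator (counted? k m (e ++ [ v ])))
        ≡⟨ Σ<-suc m _ ⟩
      Σ< m (λ v → indicator (counted? k m (e ++ [ v ]))) + indicator (counted? k m (e ++ [ m ]))
        ≡⟨ cong (_+ indicator (counted? k m (e ++ [ m ]))) (Σ<-zero m _ last≢m) ⟩
      indicator (counted? k m (e ++ [ m ]))
        ≡⟨ indicator-append-max k I ⟩
      weigh (indicator (m ≟ k)) (λ r → indicator (r ≟ k)) (shape e) ∎
      where
      last≢m : ∀ {v} → v < m → indicator (counted? k m (e ++ [ v ])) ≡ 0
      last≢m {v} v<m = indicator-no (counted? k m (e ++ [ v ]))
                         (λ (_ , _ , last≡m) → <⇒≢ v<m (trans (sym (lastEntry-snoc e v)) last≡m))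
    off-k : ∀ {r} → r ≢ k → twoPow∸2 (m ∸ r) * indicator (r ≟ k) ≡ 0
    off-k {r} r≢k = trans (cong (twoPow∸2 (m ∸ r) *_) (indicator-no (r ≟ k) r≢k)) (*-zeroʳ (twoPow∸2 (m ∸ r)))
    picks-k : Σ< m (λ r → twoPow∸2 (m ∸ r) * indicator (r ≟ k)) ≡ twoPow∸2 (m ∸ k)
    picks-k with m≤n⇒m<n∨m≡n k≤m
    ... | inj₁ k<m  = trans (Σ<-single m _ k<m (λ _ → off-k))
                            (trans (cong (twoPow∸2 (m ∸ k) *_) (indicator-yes (k ≟ k) refl)) (*-identityʳ _))
    ... | inj₂ refl = trans (Σ<-zero m _ (off-k ∘ <⇒≢)) (cong twoPow∸2 (sym (n∸n≡0 m)))

module PowerSeries where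

  open Enumeration using (f-last-max; 𝓛-coeff-above)
  open import Data.Nat.Base using (_≤_; _<_; z≤n; s≤s; _∸_)
  open import Data.Nat.Properties as ℕ using (_≤?_; _<?_; ≤-refl; ≤-pred; ≤∧≢⇒<; <⇒≢; <⇒≱; ≰⇒>; m≤n⇒m≤1+n)
  open import Data.Integer.Base using (ℤ; +_; -[1+_]; _+_; _*_; -_; _-_)
  open import Data.Integer.Properties using (+-identityˡ; +-identityʳ; neg-distrib-+; *-distribʳ-+; neg-distribˡ-*; pos-*)
  open import Data.Integer.Tactic.RingSolver using (solve-∀)
  open import Data.Empty using (⊥-elim)
  open import Data.Product.Base using (_×_; _,_; proj₁; proj₂)
  open import Function.Base using (_∘′_)
  open import Relation.Binary.PropositionalEquality
  open import Relation.Nullary using (¬_; yes; no)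

  Σ≤-cong : ∀ N {g h : ℕ → ℤ} → (∀ i → g i ≡ h i) → Σ≤ N g ≡ Σ≤ N h
  Σ≤-cong zero    g≡h = g≡h zero
  Σ≤-cong (suc N) g≡h = cong₂ _+_ (Σ≤-cong N g≡h) (g≡h (suc N))

  Σ≤-distrib-+ : ∀ N (g h : ℕ → ℤ) → Σ≤ N (λ i → g i + h i) ≡ Σ≤ N g + Σ≤ N h
  Σ≤-distrib-+ zero    g h = refl
  Σ≤-distrib-+ (suc N) g h =
    trans (cong (_+ (g (suc N) + h (suc N))) (Σ≤-distrib-+ N g h))
          (interchange (Σ≤ N g) (Σ≤ N h) (g (suc N)) (h (suc N)))
    where
    interchange : ∀ a b c d → (a + b) + (c + d) ≡ (a + c) + (b + d)
    interchange = solve-∀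

  Σ≤-neg : ∀ N (g : ℕ → ℤ) → Σ≤ N (λ i → - g i) ≡ - Σ≤ N g
  Σ≤-neg zero    g = refl
  Σ≤-neg (suc N) g =
    trans (cong (_+ - g (suc N)) (Σ≤-neg N g)) (sym (neg-distrib-+ (Σ≤ N g) (g (suc N))))

  Σ≤-zero : ∀ N (g : ℕ → ℤ) → (∀ i → i ≤ N → g i ≡ + 0) → Σ≤ N g ≡ + 0
  Σ≤-zero zero    g g≡0 = g≡0 zero z≤n
  Σ≤-zero (suc N) g g≡0 =
    cong₂ _+_ (Σ≤-zero N g (λ i i≤N → g≡0 i (m≤n⇒m≤1+n i≤N))) (g≡0 (suc N) ≤-refl)

  module _ (b : ℕ) (g : ℕ → ℤ) (g≡0 : ∀ i → i ≢ b → g i ≡ + 0) where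

    Σ≤-single : ∀ N → b ≤ N → Σ≤ N g ≡ g b
    Σ≤-single zero    z≤n = refl
    Σ≤-single (suc N) b≤1+N with b ℕ.≟ suc N
    ... | yes refl =
      trans (cong (_+ g b) (Σ≤-zero N g (λ i i≤N → g≡0 i (<⇒≢ (s≤s i≤N))))) (+-identityˡ (g b))
    ... | no b≢1+N =
      trans (cong₂ _+_ (Σ≤-single N (≤-pred (≤∧≢⇒< b≤1+N b≢1+N))) (g≡0 (suc N) (b≢1+N ∘′ sym)))
            (+-identityʳ (g b))

    Σ≤-none : ∀ N → N < b → Σ≤ N g ≡ + 0
    Σ≤-none N N<b = Σ≤-zero N g (λ i i≤N → g≡0 i (λ { refl → <⇒≱ N<b i≤N }))

  ⊛-congˡ : ∀ {A A′ : Ser} (B : Ser) → (∀ i j → A i j ≡ A′ i j) → ∀ n k → (A ⊛ B) n k ≡ (A′ ⊛ B) n k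
  ⊛-congˡ B A≡A′ n k = Σ≤-cong n (λ i → Σ≤-cong k (λ j → cong (_* B (n ∸ i) (k ∸ j)) (A≡A′ i j)))

  ⊛-distribʳ-⊕ : ∀ (A A′ B : Ser) n k → ((A ⊕ A′) ⊛ B) n k ≡ (A ⊛ B) n k + (A′ ⊛ B) n k
  ⊛-distribʳ-⊕ A A′ B n k =
    trans (Σ≤-cong n (λ i → trans (Σ≤-cong k (λ j → *-distribʳ-+ (B (n ∸ i) (k ∸ j)) (A i j) (A′ i j)))
                                  (Σ≤-distrib-+ k _ _)))
          (Σ≤-distrib-+ n _ _)

  ⊛-negˡ : ∀ (A B : Ser) n k → ((λ i j → - A i j) ⊛ B) n k ≡ - (A ⊛ B) n k
  ⊛-negˡ A B n k =
    trans (Σ≤-cong n (λ i → trans (Σ≤-cong k (λ j → sym (neg-distribˡ-* (A i j) (B (n ∸ i) (k ∸ j)))))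
                                  (Σ≤-neg k _)))
          (Σ≤-neg n _)

  ⊛-distribʳ-⊖ : ∀ (A A′ B : Ser) n k → ((A ⊖ A′) ⊛ B) n k ≡ (A ⊛ B) n k - (A′ ⊛ B) n k
  ⊛-distribʳ-⊖ A A′ B n k =
    trans (⊛-distribʳ-⊕ A (λ i j → - A′ i j) B n k) (cong (λ z → (A ⊛ B) n k + z) (⊛-negˡ A′ B n k))

  -- c xᵃ qᵇ · B, by recursion on b and a so that it computes for numerals b, a
  shift : ℤ → ℕ → ℕ → Ser → Ser
  shift c zero    zero    B n       k       = c * B n k
  shift c (suc b) a       B zero    k       = + 0
  shift c (suc b) a       B (suc n) k       = shift c b a B n k
  shift c zero    (suc a) B n       zero    = + 0
  shift c zero    (suc a) B n       (suc k) = shift c zero a B n k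

  shift-≤ : ∀ c b a B n k → b ≤ n → a ≤ k → shift c b a B n k ≡ c * B (n ∸ b) (k ∸ a)
  shift-≤ c zero    zero    B n       k       _         _         = refl
  shift-≤ c (suc b) a       B (suc n) k       (s≤s b≤n) a≤k       = shift-≤ c b a B n k b≤n a≤k
  shift-≤ c zero    (suc a) B n       (suc k) b≤n       (s≤s a≤k) = shift-≤ c zero a B n k b≤n a≤k

  shift-≰ : ∀ c b a B n k → ¬ (b ≤ n × a ≤ k) → shift c b a B n k ≡ + 0
  shift-≰ c zero    zero    B n       k       ¬≤ = ⊥-elim (¬≤ (z≤n , z≤n))
  shift-≰ c (suc b) a       B zero    k       ¬≤ = refl
  shift-≰ c (suc b) a       B (suc n) k       ¬≤ = shift-≰ c b a B n k (λ (b≤n , a≤k) → ¬≤ (s≤s b≤n , a≤k))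
  shift-≰ c zero    (suc a) B n       zero    ¬≤ = refl
  shift-≰ c zero    (suc a) B n       (suc k) ¬≤ = shift-≰ c zero a B n k (λ (b≤n , a≤k) → ¬≤ (b≤n , s≤s a≤k))

  mono-off : ∀ c b a i j → ¬ (i ≡ b × j ≡ a) → mono c b a i j ≡ + 0
  mono-off c b a i j ¬at with b ℕ.≟ i | a ℕ.≟ j
  ... | yes refl | yes refl = ⊥-elim (¬at (refl , refl))
  ... | yes _    | no _     = refl
  ... | no _     | _        = refl

  mono-at : ∀ c b a → mono c b a b a ≡ c
  mono-at c b a with b ℕ.≟ b | a ℕ.≟ a
  ... | yes _   | yes _   = refl
  ... | yes _   | no a≢a  = ⊥-elim (a≢a refl)
  ... | no b≢b  | _       = ⊥-elim (b≢b refl)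

  module _ (c : ℤ) (b a : ℕ) (B : Ser) (n k : ℕ) where

    private
      row : ℕ → ℤ
      row i = Σ≤ k (λ j → mono c b a i j * B (n ∸ i) (k ∸ j))

      row-off : ∀ i → i ≢ b → row i ≡ + 0
      row-off i i≢b = Σ≤-zero k _ (λ j _ → cong (_* B (n ∸ i) (k ∸ j)) (mono-off c b a i j (i≢b ∘′ proj₁)))

      col-off : ∀ j → j ≢ a → mono c b a b j * B (n ∸ b) (k ∸ j) ≡ + 0
      col-off j j≢a = cong (_* B (n ∸ b) (k ∸ j)) (mono-off c b a b j (j≢a ∘′ proj₂))

    mono-⊛ : (mono c b a ⊛ B) n k ≡ shift c b a B n k
    mono-⊛ with b ≤? n | a ≤? k
    ... | yes b≤n | yes a≤k = begin
      (mono c b a ⊛ B) n k                ≡⟨ Σ≤-single b row row-off n b≤n ⟩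
      row b                               ≡⟨ Σ≤-single a _ col-off k a≤k ⟩
      mono c b a b a * B (n ∸ b) (k ∸ a)  ≡⟨ cong (_* B (n ∸ b) (k ∸ a)) (mono-at c b a) ⟩
      c * B (n ∸ b) (k ∸ a)               ≡⟨ shift-≤ c b a B n k b≤n a≤k ⟨
      shift c b a B n k                   ∎
      where open ≡-Reasoning
    ... | yes b≤n | no a≰k = begin
      (mono c b a ⊛ B) n k                ≡⟨ Σ≤-single b row row-off n b≤n ⟩
      row b                               ≡⟨ Σ≤-none a _ col-off k (≰⇒> a≰k) ⟩
      + 0                                 ≡⟨ shift-≰ c b a B n k (a≰k ∘′ proj₂) ⟨
      shift c b a B n k                   ∎
      where open ≡-Reasoning
    ... | no b≰n | _ = trans (Σ≤-none b row row-off n (≰⇒> b≰n)) (sym (shift-≰ c b a B n k (b≰n ∘′ proj₁)))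

  denom-expanded : Ser
  denom-expanded = mono (+ 1) 0 0 ⊕ (mono -[1+ 1 ] 1 0 ⊕ (mono -[1+ 0 ] 1 1 ⊕ mono (+ 2) 2 1))

  denom≡expanded : ∀ n k → denom n k ≡ denom-expanded n k
  denom≡expanded n k = begin
    denom n k                                        ≡⟨ ⊛-distribʳ-⊖ 𝟙 (𝕢 ⊕ 𝕢) B n k ⟩
    (𝟙 ⊛ B) n k - ((𝕢 ⊕ 𝕢) ⊛ B) n k
      ≡⟨ cong₂ _-_ (mono-⊛ _ 0 0 B n k) (⊛-distribʳ-⊕ 𝕢 𝕢 B n k) ⟩
    shift (+ 1) 0 0 B n k - ((𝕢 ⊛ B) n k + (𝕢 ⊛ B) n k)
      ≡⟨ cong (λ z → shift (+ 1) 0 0 B n k - (z + z)) (mono-⊛ _ 1 0 B n k) ⟩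
    shift (+ 1) 0 0 B n k - (shift (+ 1) 1 0 B n k + shift (+ 1) 1 0 B n k)
      ≡⟨ by-cases n k ⟩
    denom-expanded n k                               ∎
    where
    open ≡-Reasoning
    B = 𝟙 ⊖ 𝕩𝕢
    by-cases : ∀ n k → shift (+ 1) 0 0 B n k - (shift (+ 1) 1 0 B n k + shift (+ 1) 1 0 B n k)
                       ≡ denom-expanded n k
    by-cases 0               0             = refl
    by-cases 0               1             = refl
    by-cases 0               (suc (suc k)) = refl
    by-cases 1               0             = refl
    by-cases 1               1             = refl
    by-cases 1               (suc (suc k)) = refl
    by-cases 2               0             = refl
    by-cases 2               1             = refl
    by-cases 2               (suc (suc k)) = refl
    by-cases (suc (suc (suc n))) 0             = refl
    by-cases (suc (suc (suc n))) 1             = refl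
    by-cases (suc (suc (suc n))) (suc (suc k)) = refl

  numer-coeff : ℕ → ℕ → ℤ
  numer-coeff _ (suc _) = + 0
  numer-coeff 1 0 = + 1
  numer-coeff 2 0 = -[1+ 1 ]
  numer-coeff 3 0 = + 1
  numer-coeff _ _ = + 0

  numer≡coeff : ∀ n k → numer n k ≡ numer-coeff n k
  numer≡coeff n k = trans (mono-⊛ _ 1 0 ((𝟙 ⊖ 𝕢) ⊛ (𝟙 ⊖ 𝕢)) n k) (shifted n k)
    where
    E = 𝟙 ⊖ 𝕢
    E-off : ∀ n k → E n (suc k) ≡ + 0
    E-off n k = cong₂ _-_ (mono-off _ 0 0 n (suc k) (λ ())) (mono-off _ 1 0 n (suc k) (λ ()))
    E² : ∀ n k → (E ⊛ E) n k ≡ shift (+ 1) 0 0 E n k - shift (+ 1) 1 0 E n k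
    E² n k = trans (⊛-distribʳ-⊖ 𝟙 𝕢 E n k) (cong₂ _-_ (mono-⊛ _ 0 0 E n k) (mono-⊛ _ 1 0 E n k))
    shifted : ∀ n k → shift (+ 1) 1 0 (E ⊛ E) n k ≡ numer-coeff n k
    shifted 0                         0       = refl
    shifted 0                         (suc k) = refl
    shifted 1                         0       = cong (+ 1 *_) (E² 0 0)
    shifted 2                         0       = cong (+ 1 *_) (E² 1 0)
    shifted 3                         0       = cong (+ 1 *_) (E² 2 0)
    shifted (suc (suc (suc (suc n)))) 0       = cong (+ 1 *_) (E² (suc (suc (suc n))) 0)
    shifted (suc zero)                (suc k) = cong (+ 1 *_) (trans (E² 0 (suc k)) (cong (λ z → + 1 * z - + 0) (E-off 0 k)))
    shifted (suc (suc n))             (suc k) = cong (+ 1 *_) (trans (E² (suc n) (suc k))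
      (cong₂ (λ z w → + 1 * z - + 1 * w) (E-off (suc n) k) (E-off n k)))

  mono⊕-⊛ : ∀ c b a (A B : Ser) n k → ((mono c b a ⊕ A) ⊛ B) n k ≡ shift c b a B n k + (A ⊛ B) n k
  mono⊕-⊛ c b a A B n k = trans (⊛-distribʳ-⊕ (mono c b a) A B n k) (cong (_+ (A ⊛ B) n k) (mono-⊛ c b a B n k))

  product-shifts : Ser
  product-shifts n k =
    shift (+ 1) 0 0 𝓛 n k + (shift -[1+ 1 ] 1 0 𝓛 n k + (shift -[1+ 0 ] 1 1 𝓛 n k + shift (+ 2) 2 1 𝓛 n k))

  product-expanded : ∀ n k → (denom ⊛ 𝓛) n k ≡ product-shifts n k
  product-expanded n k = begin
    (denom ⊛ 𝓛) n k            ≡⟨ ⊛-congˡ 𝓛 denom≡expanded n k ⟩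
    (denom-expanded ⊛ 𝓛) n k   ≡⟨ mono⊕-⊛ _ 0 0 _ 𝓛 n k ⟩
    shift (+ 1) 0 0 𝓛 n k + _  ≡⟨ cong (λ z → shift (+ 1) 0 0 𝓛 n k + z) (mono⊕-⊛ _ 1 0 _ 𝓛 n k) ⟩
    shift (+ 1) 0 0 𝓛 n k + (shift -[1+ 1 ] 1 0 𝓛 n k + _)
      ≡⟨ cong (λ z → shift (+ 1) 0 0 𝓛 n k + (shift -[1+ 1 ] 1 0 𝓛 n k + z))
              (trans (mono⊕-⊛ _ 1 1 _ 𝓛 n k) (cong (λ z → shift -[1+ 0 ] 1 1 𝓛 n k + z) (mono-⊛ _ 2 1 𝓛 n k))) ⟩
    product-shifts n k         ∎
    where open ≡-Reasoning

  𝓛-closed : ∀ m k → 𝓛 (suc m) k ≡ + 𝓛-coeff m k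
  𝓛-closed m k with k <? suc m
  ... | yes k≤m = cong +_ (f-last-max m k (≤-pred k≤m))
  ... | no  k≰m = cong +_ (sym (𝓛-coeff-above m k (≰⇒> (k≰m ∘′ s≤s))))

  𝓛-shift : ∀ m k → 𝓛 (suc m) (suc k) ≡ 𝓛 m k
  𝓛-shift zero    k = 𝓛-closed zero (suc k)
  𝓛-shift (suc m) k = trans (𝓛-closed (suc m) (suc k)) (sym (𝓛-closed m k))

  product-shifts≡numer-coeff : ∀ n k → product-shifts n k ≡ numer-coeff n k
  product-shifts≡numer-coeff zero          zero    = refl
  product-shifts≡numer-coeff zero          (suc k) = refl
  product-shifts≡numer-coeff (suc zero)    zero    = cong (λ a → + 1 * a + (-[1+ 1 ] * + 0 + + 0)) (𝓛-closed 0 0)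
  product-shifts≡numer-coeff (suc zero)    (suc k) =
    cong (λ a → + 1 * a + (-[1+ 1 ] * + 0 + (-[1+ 0 ] * + 0 + + 0))) (𝓛-closed 0 (suc k))
  product-shifts≡numer-coeff (suc (suc m)) zero    =
    trans (cong₂ (λ a b → + 1 * a + (-[1+ 1 ] * b + + 0)) (𝓛-closed (suc m) 0) (𝓛-closed m 0)) (first-column m)
    where
    first-column : ∀ m → + 1 * + 𝓛-coeff (suc m) 0 + (-[1+ 1 ] * + 𝓛-coeff m 0 + + 0) ≡ numer-coeff (suc (suc m)) 0
    first-column zero          = refl
    first-column (suc zero)    = refl
    first-column (suc (suc d)) =
      trans (cong (λ z → + 1 * z + (-[1+ 1 ] * + 2 ^ d + + 0)) (pos-* 2 (2 ^ d))) (doubling-cancels (+ 2 ^ d))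
      where
      doubling-cancels : ∀ a → + 1 * (+ 2 * a) + (-[1+ 1 ] * a + + 0) ≡ + 0
      doubling-cancels = solve-∀
  product-shifts≡numer-coeff (suc (suc m)) (suc k) =
    trans (cong₂ (λ a b → + 1 * a + (-[1+ 1 ] * b + (-[1+ 0 ] * 𝓛 (suc m) k + + 2 * 𝓛 m k)))
                 (𝓛-shift (suc m) k) (𝓛-shift m k))
          (cancel (𝓛 (suc m) k) (𝓛 m k))
    where
    cancel : ∀ a b → + 1 * a + (-[1+ 1 ] * b + (-[1+ 0 ] * a + + 2 * b)) ≡ + 0
    cancel = solve-∀

theorem4p1 : (n k : ℕ) → (denom ⊛ 𝓛) n k ≡ numer n k
theorem4p1 n k = trans (product-expanded n k) (trans (product-shifts≡numer-coeff n k) (sym (numer≡coeff n k)))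
  where open PowerSeries
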